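{- Let $d,k\in\mathbb N^+$ and $G=(V,E)$ a graph. If $|V^G_{[1,d]}|>(d+1)\cdot(k-1)^2$, then $G$ contains a $k$-edge induced subgraph.
   Context: Graphs are simple, finite, with nonempty vertex set. $V^G_{[1,d]}:=\{v\in V: 1\le\deg(v)\le d\}$. A $k$-edge induced subgraph of $G$ is $G[S]$ for some nonempty $S\subseteq V$ with exactly $k$ edges. -}

module Defs where

open import Data.Nat using (ℕ; suc; _+_; _*_; _≤ᵇ_; _<ᵇ_)
open import Data.Bool using (Bool; true; false; if_then_else_; _∧_)
open import Data.Fin using (Fin; toℕ)
open import Data.Fin.Subset using (Subset; _∈_; Nonempty)
open import Data.List using (map; allFin)
open import Data.Nat.ListAction using (sum)
open import Data.Product using (Σ; _×_)
open import Data.Vec using (lookup)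
open import Relation.Binary.PropositionalEquality using (_≡_)

record Graph (n : ℕ) : Set where
  field
    adj   : Fin n → Fin n → Bool
    sym   : ∀ i j → adj i j ≡ adj j i
    irrefl : ∀ i → adj i i ≡ false
open Graph public

count : ∀ {n} → (Fin n → Bool) → ℕ
count {n} P = sum (map (λ i → if P i then 1 else 0) (allFin n))

degree : ∀ {n} → Graph n → Fin n → ℕ
degree G v = count (adj G v)

lowDegCount : ∀ {n} → Graph n → ℕ → ℕ
lowDegCount G d = count (λ v → (1 ≤ᵇ degree G v) ∧ (degree G v ≤ᵇ d))

-- number of edges of the induced subgraph G[S]: unordered pairs {i,j}
-- (counted once via toℕ i < toℕ j) with i,j ∈ S adjacent in G
inducedEdges : ∀ {n} → Graph n → Subset n → ℕ
inducedEdges {n} G S =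
  sum (map (λ i → count (λ j → (toℕ i <ᵇ toℕ j) ∧ lookup S i ∧ lookup S j ∧ adj G i j))
           (allFin n))

HasKEdgeInducedSubgraph : ∀ {n} → Graph n → ℕ → Set
HasKEdgeInducedSubgraph {n} G k =
  Σ (Subset n) (λ S → Nonempty S × (inducedEdges G S ≡ k))

module Submission where

-- Let L be the set of vertices of degree in [1, d] and I a maximal independent subset of L.
-- The closed neighbourhoods of the vertices of I cover L and have at most d + 1 vertices,
-- so |I| > (k - 1)². If some vertex has k neighbours in I, it induces a star with k of them.
-- Otherwise take a minimal set W dominating I from outside: every vertex sees at most k - 1
-- vertices of I, so |W| ≥ k, and every w ∈ W has a private neighbour in I. Adding r private
-- neighbours to W raises its edge count by exactly r, while deleting a vertex of W loses at
-- most |W| - 1 edges; so by induction on |W| every number up to e(W) + |W| ≥ k is the edge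
-- count of an induced subgraph.

open import Defs hiding (sym)
open import Data.Nat using (ℕ; zero; suc; _+_; _*_; _∸_; _^_; _>_; _≤_; _<_; z≤n; s≤s; _≤ᵇ_; _<ᵇ_; _≡ᵇ_; _≤?_)
open import Data.Nat.Properties hiding (_≟_)
open import Data.Nat.Tactic.RingSolver using (solve-∀)
import Data.Nat.ListAction as List
open import Data.Bool using (Bool; true; false; if_then_else_; _∧_; _∨_; not)
open import Data.Bool.Properties using (_≟_; ¬-not; T-≡; ∧-zeroʳ)
import Data.Fin as Fin
open import Data.Fin using (Fin; toℕ; punchIn)
open import Data.Fin.Properties using (any?; all?; ¬∀⟶∃¬; punchInᵢ≢i) renaming (_≟_ to _≟ᶠ_; <-cmp to <ᶠ-cmp)
open import Data.List using ([]; _∷_; map; tabulate; allFin)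
open import Data.List.Membership.Propositional using (_∈_)
open import Data.List.Membership.Propositional.Properties using (∈-allFin)
open import Data.List.Relation.Unary.Any using (here; there)
import Data.Vec as Vec
open import Data.Vec.Properties using (lookup∘tabulate; lookup⇒[]=)
open import Data.Vec.Functional using (Vector)
open import Data.Product using (_×_; _,_; ∃-syntax)
open import Data.Sum using (_⊎_; inj₁; inj₂; [_,_]′)
open import Function using (_∘_; id; Equivalence)
open import Relation.Binary using (tri<; tri≈; tri>)
open import Relation.Nullary using (¬_; Dec; yes; no; does; contradiction)
open import Relation.Nullary.Decidable using (dec-true; dec-false; _→-dec_; _×-dec_)
open import Relation.Binary.PropositionalEquality
  using (_≡_; _≢_; _≗_; refl; sym; trans; cong; cong₂; subst; module ≡-Reasoning)
open import Algebra.Properties.Semiring.Sum +-*-semiring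
  using (sum; sum-syntax; sum-remove; ∑-comm; ∑-distrib-+; sum-cong-≗; sum-replicate-zero; *-distribˡ-sum)

∑-mono-≤ : ∀ {n} {f g : Vector ℕ n} → (∀ i → f i ≤ g i) → sum f ≤ sum g
∑-mono-≤ {zero}  f≤g = z≤n
∑-mono-≤ {suc n} f≤g = +-mono-≤ (f≤g Fin.zero) (∑-mono-≤ (f≤g ∘ Fin.suc))

f≤∑f : ∀ {n} (f : Vector ℕ n) i → f i ≤ sum f
f≤∑f {suc n} f i = begin
  f i                          ≤⟨ m≤m+n (f i) _ ⟩
  f i + sum (f ∘ punchIn i)    ≡⟨ sum-remove f ⟨
  sum f                        ∎
  where open ≤-Reasoning

sum-map-tabulate : ∀ {A : Set} {n} (f : A → ℕ) (g : Fin n → A) →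
                   List.sum (map f (tabulate g)) ≡ ∑[ i < n ] f (g i)
sum-map-tabulate {n = zero}  f g = refl
sum-map-tabulate {n = suc n} f g = cong (f (g _) +_) (sum-map-tabulate f (g ∘ Fin.suc))

-- Subsets of Fin n as Boolean vectors

module _ {n : ℕ} where

  infixr 7 _∩_
  infixr 6 _∪_ _─_
  infix  4 _⊆_

  ∅ : Vector Bool n
  ∅ _ = false

  ⁅_⁆ : Fin n → Vector Bool n
  ⁅ v ⁆ i = does (i ≟ᶠ v)

  ∁ : Vector Bool n → Vector Bool n
  ∁ A i = not (A i)

  _∪_ _∩_ _─_ : Vector Bool n → Vector Bool n → Vector Bool n
  (A ∪ B) i = A i ∨ B i
  (A ∩ B) i = A i ∧ B i
  A ─ B = A ∩ ∁ B

  _⊆_ : Vector Bool n → Vector Bool n → Set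
  A ⊆ B = ∀ i → A i ≡ true → B i ≡ true

  Disjoint : Vector Bool n → Vector Bool n → Set
  Disjoint A B = A ∩ B ≗ ∅

  _⊆?_ : ∀ A B → Dec (A ⊆ B)
  A ⊆? B = all? λ i → (A i ≟ true) →-dec (B i ≟ true)

  ⁅⁆-self : ∀ v → ⁅ v ⁆ v ≡ true
  ⁅⁆-self v = dec-true (v ≟ᶠ v) refl

  ⁅⁆-other : ∀ {v i} → i ≢ v → ⁅ v ⁆ i ≡ false
  ⁅⁆-other {v} {i} = dec-false (i ≟ᶠ v)

  ⁅⁆⇒≡ : ∀ v i → ⁅ v ⁆ i ≡ true → i ≡ v
  ⁅⁆⇒≡ v i i∈⁅v⁆ with i ≟ᶠ v
  ... | yes i≡v = i≡v

  ∪⁻ : ∀ A B i → (A ∪ B) i ≡ true → A i ≡ true ⊎ B i ≡ true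
  ∪⁻ A B i A∪Bi with A i
  ... | true  = inj₁ refl
  ... | false = inj₂ A∪Bi

  ∪⁺ˡ : ∀ A B i → A i ≡ true → (A ∪ B) i ≡ true
  ∪⁺ˡ A B i Ai rewrite Ai = refl

  ∪⁺ʳ : ∀ A B i → B i ≡ true → (A ∪ B) i ≡ true
  ∪⁺ʳ A B i Bi rewrite Bi with A i
  ... | true  = refl
  ... | false = refl

  ∩⁺ : ∀ A B i → A i ≡ true → B i ≡ true → (A ∩ B) i ≡ true
  ∩⁺ A B i Ai Bi rewrite Ai | Bi = refl

  ∩⁻ˡ : ∀ A B i → (A ∩ B) i ≡ true → A i ≡ true
  ∩⁻ˡ A B i A∩Bi with A i
  ... | true = refl

  ∩⁻ʳ : ∀ A B i → (A ∩ B) i ≡ true → B i ≡ true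
  ∩⁻ʳ A B i A∩Bi with A i
  ... | true = A∩Bi

  ∁⁺ : ∀ A i → A i ≡ false → ∁ A i ≡ true
  ∁⁺ A i Ai rewrite Ai = refl

  ∁⁻ : ∀ A i → ∁ A i ≡ true → A i ≡ false
  ∁⁻ A i ∁Ai with A i
  ... | false = refl

  ─⁅⁆⁺ : ∀ A {v i} → A i ≡ true → i ≢ v → (A ─ ⁅ v ⁆) i ≡ true
  ─⁅⁆⁺ A {v} Ai i≢v rewrite Ai | ⁅⁆-other {v} i≢v = refl

  ⊆⇒∉ : ∀ A B i → A ⊆ B → B i ≡ false → A i ≡ false
  ⊆⇒∉ A B i A⊆B Bi = ¬-not λ Ai → contradiction (trans (sym Bi) (A⊆B i Ai)) λ ()

  ∪-monoˡ : ∀ {A B} C → A ⊆ B → A ∪ C ⊆ B ∪ C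
  ∪-monoˡ {A} {B} C A⊆B i A∪Ci with ∪⁻ A C i A∪Ci
  ... | inj₁ Ai = ∪⁺ˡ B C i (A⊆B i Ai)
  ... | inj₂ Ci = ∪⁺ʳ B C i Ci

  ─-antimonoʳ : ∀ A {X Y} → X ⊆ Y → A ─ Y ⊆ A ─ X
  ─-antimonoʳ A {X} {Y} X⊆Y i A─Yi =
    ∩⁺ A (∁ X) i (∩⁻ˡ A (∁ Y) i A─Yi) (∁⁺ X i (⊆⇒∉ X Y i X⊆Y (∁⁻ Y i (∩⁻ʳ A (∁ Y) i A─Yi))))

  ─-disjoint : ∀ A B → Disjoint (A ─ B) B
  ─-disjoint A B i with A i | B i
  ... | true  | true  = refl
  ... | true  | false = refl
  ... | false | _     = refl

  ─⁅⁆-∪⁅⁆ : ∀ A v → A v ≡ true → A ≗ (A ─ ⁅ v ⁆) ∪ ⁅ v ⁆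
  ─⁅⁆-∪⁅⁆ A v Av i with i ≟ᶠ v
  ... | yes refl rewrite Av = refl
  ... | no _ with A i
  ...   | true  = refl
  ...   | false = refl

ind : Bool → ℕ
ind b = if b then 1 else 0

∑∈ : ∀ {n} → Vector Bool n → Vector ℕ n → ℕ
∑∈ A f = sum (λ i → if A i then f i else 0)

count≡∑∈ : ∀ {n} (A : Vector Bool n) → count A ≡ ∑∈ A (λ _ → 1)
count≡∑∈ A = sum-map-tabulate (λ i → if A i then 1 else 0) id

private
  variable
    n : ℕ
    A B : Vector Bool n

∑∈-∪ : (A B : Vector Bool n) (f : Vector ℕ n) → Disjoint A B → ∑∈ (A ∪ B) f ≡ ∑∈ A f + ∑∈ B f
∑∈-∪ A B f A∩B≗∅ = trans (sum-cong-≗ λ i → split (A i) (B i) (A∩B≗∅ i))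
                         (∑-distrib-+ (λ i → if A i then f i else 0) (λ i → if B i then f i else 0))
  where
  split : ∀ a b {x} → a ∧ b ≡ false → (if a ∨ b then x else 0) ≡ (if a then x else 0) + (if b then x else 0)
  split false _     _ = refl
  split true  false _ = sym (+-identityʳ _)

∑∈-≤ : (A : Vector Bool n) {f : Vector ℕ n} {b : ℕ} → (∀ i → A i ≡ true → f i ≤ b) → ∑∈ A f ≤ b * count A
∑∈-≤ A {f} {b} f≤b = begin
  ∑∈ A f                     ≤⟨ ∑-mono-≤ bound ⟩
  sum (λ i → b * ind (A i))  ≡⟨ *-distribˡ-sum b (ind ∘ A) ⟨
  b * ∑∈ A (λ _ → 1)         ≡⟨ cong (b *_) (count≡∑∈ A) ⟨
  b * count A                ∎
  where
  open ≤-Reasoning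
  bound : ∀ i → (if A i then f i else 0) ≤ b * ind (A i)
  bound i with A i in Ai
  ... | false = z≤n
  ... | true  = subst (f i ≤_) (sym (*-identityʳ b)) (f≤b i Ai)

∑∈-≡count : (A : Vector Bool n) {f : Vector ℕ n} → (∀ i → A i ≡ true → f i ≡ 1) → ∑∈ A f ≡ count A
∑∈-≡count A {f} f≡1 = trans (sum-cong-≗ pointwise) (sym (count≡∑∈ A))
  where
  pointwise : ∀ i → (if A i then f i else 0) ≡ ind (A i)
  pointwise i with A i in Ai
  ... | false = refl
  ... | true  = f≡1 i Ai

count-≤-∑∈ : (A B : Vector Bool n) (R : Fin n → Vector Bool n) →
             (∀ v → A v ≡ true → ∃[ u ] B u ≡ true × R u v ≡ true) →
             count A ≤ ∑∈ B (count ∘ R)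
count-≤-∑∈ {n} A B R covered = begin
  count A                                  ≡⟨ count≡∑∈ A ⟩
  sum (ind ∘ A)                            ≤⟨ ∑-mono-≤ pairs-at ⟩
  ∑[ v < n ] ∑[ u < n ] ind (B u ∧ R u v)  ≡⟨ ∑-comm (λ v u → ind (B u ∧ R u v)) ⟩
  ∑[ u < n ] ∑[ v < n ] ind (B u ∧ R u v)  ≡⟨ sum-cong-≗ pairs-from ⟩
  ∑∈ B (count ∘ R)                         ∎
  where
  open ≤-Reasoning
  pairs-at : ∀ v → ind (A v) ≤ ∑[ u < n ] ind (B u ∧ R u v)
  pairs-at v with A v in Av
  ... | false = z≤n
  ... | true with covered v Av
  ...   | u , Bu , Ruv = subst (_≤ _) (cong ind (cong₂ _∧_ Bu Ruv)) (f≤∑f (λ u → ind (B u ∧ R u v)) u)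
  pairs-from : ∀ u → ∑[ v < n ] ind (B u ∧ R u v) ≡ (if B u then count (R u) else 0)
  pairs-from u with B u
  ... | true  = sym (count≡∑∈ (R u))
  ... | false = sum-replicate-zero n

count-cong : A ≗ B → count A ≡ count B
count-cong {A = A} {B = B} A≗B = begin
  count A             ≡⟨ count≡∑∈ A ⟩
  ∑∈ A (λ _ → 1)      ≡⟨ sum-cong-≗ (cong ind ∘ A≗B) ⟩
  ∑∈ B (λ _ → 1)      ≡⟨ count≡∑∈ B ⟨
  count B             ∎
  where open ≡-Reasoning

count-mono : A ⊆ B → count A ≤ count B
count-mono {A = A} {B = B} A⊆B = begin
  count A             ≡⟨ count≡∑∈ A ⟩
  ∑∈ A (λ _ → 1)      ≤⟨ ∑-mono-≤ ind-mono ⟩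
  ∑∈ B (λ _ → 1)      ≡⟨ count≡∑∈ B ⟨
  count B             ∎
  where
  open ≤-Reasoning
  ind-mono : ∀ i → ind (A i) ≤ ind (B i)
  ind-mono i with A i in Ai
  ... | false = z≤n
  ... | true rewrite A⊆B i Ai = ≤-refl

count-∅ : count (∅ {n}) ≡ 0
count-∅ {n} = trans (count≡∑∈ (∅ {n})) (sum-replicate-zero n)

count-∪ : (A B : Vector Bool n) → Disjoint A B → count (A ∪ B) ≡ count A + count B
count-∪ A B A∩B≗∅ = begin
  count (A ∪ B)                              ≡⟨ count≡∑∈ (A ∪ B) ⟩
  ∑∈ (A ∪ B) (λ _ → 1)                       ≡⟨ ∑∈-∪ A B (λ _ → 1) A∩B≗∅ ⟩
  ∑∈ A (λ _ → 1) + ∑∈ B (λ _ → 1)            ≡⟨ cong₂ _+_ (count≡∑∈ A) (count≡∑∈ B) ⟨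
  count A + count B                          ∎
  where open ≡-Reasoning

count-⁅⁆ : (v : Fin n) → count ⁅ v ⁆ ≡ 1
count-⁅⁆ {suc n} v = begin
  count ⁅ v ⁆                                          ≡⟨ count≡∑∈ ⁅ v ⁆ ⟩
  sum (ind ∘ ⁅ v ⁆)                                    ≡⟨ sum-remove {i = v} (ind ∘ ⁅ v ⁆) ⟩
  ind (⁅ v ⁆ v) + ∑[ j < n ] ind (⁅ v ⁆ (punchIn v j))
    ≡⟨ cong₂ _+_ (cong ind (⁅⁆-self v)) (sum-cong-≗ (cong ind ∘ ⁅⁆-other ∘ punchInᵢ≢i v)) ⟩
  1 + ∑[ j < n ] 0                                     ≡⟨ cong suc (sum-replicate-zero n) ⟩
  1                                                    ∎
  where open ≡-Reasoning

∈⇒1≤count : (A : Vector Bool n) (v : Fin n) → A v ≡ true → 1 ≤ count A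
∈⇒1≤count A v Av = begin
  1                   ≡⟨ cong ind Av ⟨
  ind (A v)           ≤⟨ f≤∑f (ind ∘ A) v ⟩
  ∑∈ A (λ _ → 1)      ≡⟨ count≡∑∈ A ⟨
  count A             ∎
  where open ≤-Reasoning

count≡1 : (A : Vector Bool n) (v : Fin n) → A v ≡ true → A ⊆ ⁅ v ⁆ → count A ≡ 1
count≡1 A v Av A⊆⁅v⁆ = ≤-antisym (≤-trans (count-mono A⊆⁅v⁆) (≤-reflexive (count-⁅⁆ v))) (∈⇒1≤count A v Av)

∃-member : (A : Vector Bool n) → 0 < count A → ∃[ v ] A v ≡ true
∃-member {n} A 0<∣A∣ with any? (λ v → A v ≟ true)
... | yes ∃v = ∃v
... | no ∄v = contradiction (subst (0 <_) (trans (count-cong A≗∅) (count-∅ {n})) 0<∣A∣) λ ()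
  where
  A≗∅ : A ≗ ∅
  A≗∅ i = ¬-not λ Ai → ∄v (i , Ai)

count-─⁅⁆ : (A : Vector Bool n) (v : Fin n) → A v ≡ true → count A ≡ suc (count (A ─ ⁅ v ⁆))
count-─⁅⁆ A v Av = begin
  count A                              ≡⟨ count-cong (─⁅⁆-∪⁅⁆ A v Av) ⟩
  count ((A ─ ⁅ v ⁆) ∪ ⁅ v ⁆)          ≡⟨ count-∪ (A ─ ⁅ v ⁆) ⁅ v ⁆ (─-disjoint A ⁅ v ⁆) ⟩
  count (A ─ ⁅ v ⁆) + count ⁅ v ⁆      ≡⟨ cong (count (A ─ ⁅ v ⁆) +_) (count-⁅⁆ v) ⟩
  count (A ─ ⁅ v ⁆) + 1                ≡⟨ +-comm _ 1 ⟩
  suc (count (A ─ ⁅ v ⁆))              ∎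
  where open ≡-Reasoning

⊆-of-size : (A : Vector Bool n) (r : ℕ) → r ≤ count A → ∃[ B ] B ⊆ A × count B ≡ r
⊆-of-size {n} A r r≤∣A∣ = shrink (count A ∸ r) A (sym (m+[n∸m]≡n r≤∣A∣))
  where
  shrink : ∀ m (A : Vector Bool n) → count A ≡ r + m → ∃[ B ] B ⊆ A × count B ≡ r
  shrink zero    A ∣A∣≡r+0 = A , (λ _ Ai → Ai) , trans ∣A∣≡r+0 (+-identityʳ r)
  shrink (suc m) A ∣A∣≡r+1+m with ∃-member A (subst (0 <_) (sym ∣A∣≡r+1+m) (≤-trans (s≤s z≤n) (m≤n+m (suc m) r)))
  ... | v , Av with shrink m (A ─ ⁅ v ⁆)
                     (suc-injective (trans (sym (count-─⁅⁆ A v Av)) (trans ∣A∣≡r+1+m (+-suc r m))))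
  ...   | B , B⊆A─v , ∣B∣≡r = B , (λ i → ∩⁻ˡ A (∁ ⁅ v ⁆) i ∘ B⊆A─v i) , ∣B∣≡r

-- Maximal and minimal subsets with a decidable property

extend-to-maximal : {P : Vector Bool n → Set} → (∀ A → Dec (P A)) → (∀ {A B} → A ⊆ B → P B → P A) →
                    ∀ vs A → P A → ∃[ M ] A ⊆ M × P M × (∀ v → v ∈ vs → M v ≡ true ⊎ ¬ P (M ∪ ⁅ v ⁆))
extend-to-maximal P? P-⊆ [] A PA = A , (λ _ Ai → Ai) , PA , λ _ ()
extend-to-maximal P? P-⊆ (v ∷ vs) A PA with P? (A ∪ ⁅ v ⁆)
... | yes PA∪v with extend-to-maximal P? P-⊆ vs (A ∪ ⁅ v ⁆) PA∪v
...   | M , A∪v⊆M , PM , max = M , (λ i → A∪v⊆M i ∘ ∪⁺ˡ A ⁅ v ⁆ i) , PM , λ where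
          w (here refl)  → inj₁ (A∪v⊆M w (∪⁺ʳ A ⁅ w ⁆ w (⁅⁆-self w)))
          w (there w∈vs) → max w w∈vs
extend-to-maximal P? P-⊆ (v ∷ vs) A PA | no ¬PA∪v with extend-to-maximal P? P-⊆ vs A PA
...   | M , A⊆M , PM , max = M , A⊆M , PM , λ where
          w (here refl)  → inj₂ (¬PA∪v ∘ P-⊆ (∪-monoˡ ⁅ w ⁆ A⊆M))
          w (there w∈vs) → max w w∈vs

∃-maximal : {P : Vector Bool n → Set} → (∀ A → Dec (P A)) → (∀ {A B} → A ⊆ B → P B → P A) →
            P ∅ → ∃[ M ] P M × (∀ v → M v ≡ true ⊎ ¬ P (M ∪ ⁅ v ⁆))
∃-maximal {n} P? P-⊆ P∅ with extend-to-maximal P? P-⊆ (allFin n) ∅ P∅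
... | M , _ , PM , max = M , PM , λ v → max v (∈-allFin v)

-- The minimal set is W ─ X for a maximal X with Q (W ─ X).
∃-minimal : {Q : Vector Bool n → Set} → (∀ A → Dec (Q A)) → (∀ {A B} → A ⊆ B → Q A → Q B) →
            ∀ {W} → Q W → ∃[ M ] Q M × (∀ v → M v ≡ true → ¬ Q (M ─ ⁅ v ⁆))
∃-minimal {Q = Q} Q? Q-⊆ {W} QW =
  complement (∃-maximal (λ X → Q? (W ─ X)) (Q-⊆ ∘ ─-antimonoʳ W) (Q-⊆ (λ i Wi → ∩⁺ W (∁ ∅) i Wi refl) QW))
  where
  ─-∪ : ∀ a b c → (a ∧ not b) ∧ not c ≡ a ∧ not (b ∨ c)
  ─-∪ false _     _ = refl
  ─-∪ true  false _ = refl
  ─-∪ true  true  _ = refl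
  complement : ∃[ X ] Q (W ─ X) × (∀ v → X v ≡ true ⊎ ¬ Q (W ─ (X ∪ ⁅ v ⁆))) →
               ∃[ M ] Q M × (∀ v → M v ≡ true → ¬ Q (M ─ ⁅ v ⁆))
  complement (X , QW─X , max) = W ─ X , QW─X , minimal
    where
    minimal : ∀ v → (W ─ X) v ≡ true → ¬ Q ((W ─ X) ─ ⁅ v ⁆)
    minimal v W─Xv with max v
    ... | inj₁ Xv = contradiction (trans (sym Xv) (∁⁻ X v (∩⁻ʳ W (∁ X) v W─Xv))) λ ()
    ... | inj₂ ¬Q = ¬Q ∘ Q-⊆ (λ i → trans (sym (─-∪ (W i) (X i) (⁅ v ⁆ i))))

-- Edges of induced subgraphs

<ᵇ-true : ∀ {m n} → m < n → (m <ᵇ n) ≡ true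
<ᵇ-true m<n = Equivalence.to T-≡ (<⇒<ᵇ m<n)

<ᵇ-false : ∀ {m n} → ¬ m < n → (m <ᵇ n) ≡ false
<ᵇ-false {m} {n} m≮n = ¬-not (m≮n ∘ <ᵇ⇒< m n ∘ Equivalence.from T-≡)

module _ {n : ℕ} (G : Graph n) where

  deg[_] : Vector Bool n → Fin n → ℕ
  deg[ A ] v = count (A ∩ adj G v)

  arcs : Vector Bool n → Vector Bool n → ℕ
  arcs A B = ∑∈ A deg[ B ]

  edges : Vector Bool n → ℕ
  edges A = ∑[ i < n ] ∑[ j < n ] ind ((toℕ i <ᵇ toℕ j) ∧ A i ∧ A j ∧ adj G i j)

  Independent : Vector Bool n → Set
  Independent A = ∀ i j → A i ≡ true → A j ≡ true → adj G i j ≡ false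

  arcs-∑∑ : ∀ A B → arcs A B ≡ ∑[ i < n ] ∑[ j < n ] ind (A i ∧ B j ∧ adj G i j)
  arcs-∑∑ A B = sum-cong-≗ row
    where
    row : ∀ i → (if A i then deg[ B ] i else 0) ≡ ∑[ j < n ] ind (A i ∧ B j ∧ adj G i j)
    row i with A i
    ... | true  = count≡∑∈ (B ∩ adj G i)
    ... | false = sym (sum-replicate-zero n)

  arc-sym : ∀ (A B : Vector Bool n) i j → A i ∧ B j ∧ adj G i j ≡ B j ∧ A i ∧ adj G j i
  arc-sym A B i j rewrite Graph.sym G i j with A i | B j
  ... | false | false = refl
  ... | false | true  = refl
  ... | true  | _     = refl

  arcs-comm : ∀ A B → arcs A B ≡ arcs B A
  arcs-comm A B = begin
    arcs A B                                           ≡⟨ arcs-∑∑ A B ⟩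
    ∑[ i < n ] ∑[ j < n ] ind (A i ∧ B j ∧ adj G i j)  ≡⟨ ∑-comm (λ i j → ind (A i ∧ B j ∧ adj G i j)) ⟩
    ∑[ j < n ] ∑[ i < n ] ind (A i ∧ B j ∧ adj G i j)
      ≡⟨ sum-cong-≗ (λ j → sum-cong-≗ (λ i → cong ind (arc-sym A B i j))) ⟩
    ∑[ j < n ] ∑[ i < n ] ind (B j ∧ A i ∧ adj G j i)  ≡⟨ arcs-∑∑ B A ⟨
    arcs B A                                           ∎
    where open ≡-Reasoning

  arcs-∪ʳ : ∀ A B C → Disjoint B C → arcs A (B ∪ C) ≡ arcs A B + arcs A C
  arcs-∪ʳ A B C B∩C≗∅ = begin
    arcs A (B ∪ C)        ≡⟨ arcs-comm A (B ∪ C) ⟩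
    arcs (B ∪ C) A        ≡⟨ ∑∈-∪ B C deg[ A ] B∩C≗∅ ⟩
    arcs B A + arcs C A   ≡⟨ cong₂ _+_ (arcs-comm B A) (arcs-comm C A) ⟩
    arcs A B + arcs A C   ∎
    where open ≡-Reasoning

  arcs-≤ : ∀ A B → arcs B A ≤ count A * count B
  arcs-≤ A B = ∑∈-≤ B λ v _ → count-mono (∩⁻ˡ A (adj G v))

  edges-double : ∀ A → 2 * edges A ≡ arcs A A
  edges-double A = begin
    edges A + (edges A + 0)
      ≡⟨ cong (edges A +_) (trans (+-identityʳ (edges A)) (∑-comm f)) ⟩
    edges A + ∑[ i < n ] ∑[ j < n ] f j i
      ≡⟨ ∑-distrib-+ (λ i → ∑[ j < n ] f i j) (λ i → ∑[ j < n ] f j i) ⟨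
    ∑[ i < n ] (∑[ j < n ] f i j + ∑[ j < n ] f j i)  ≡⟨ sum-cong-≗ (λ i → ∑-distrib-+ (f i) (λ j → f j i)) ⟨
    ∑[ i < n ] ∑[ j < n ] (f i j + f j i)             ≡⟨ sum-cong-≗ (λ i → sum-cong-≗ (pair i)) ⟩
    ∑[ i < n ] ∑[ j < n ] ind (A i ∧ A j ∧ adj G i j) ≡⟨ arcs-∑∑ A A ⟨
    arcs A A                                          ∎
    where
    open ≡-Reasoning
    f : Fin n → Fin n → ℕ
    f i j = ind ((toℕ i <ᵇ toℕ j) ∧ A i ∧ A j ∧ adj G i j)
    pair : ∀ i j → f i j + f j i ≡ ind (A i ∧ A j ∧ adj G i j)
    pair i j rewrite arc-sym A A j i with <ᶠ-cmp i j
    ... | tri< i<j _ j≮i rewrite <ᵇ-true i<j | <ᵇ-false j≮i = +-identityʳ _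
    ... | tri> i≮j _ j<i rewrite <ᵇ-false i≮j | <ᵇ-true j<i = refl
    ... | tri≈ i≮i refl _ rewrite <ᵇ-false i≮i | Graph.irrefl G i | ∧-zeroʳ (A i) | ∧-zeroʳ (A i) = refl

  edges-cong : ∀ {A B} → A ≗ B → edges A ≡ edges B
  edges-cong A≗B = sum-cong-≗ λ i → sum-cong-≗ λ j →
    cong₂ (λ a b → ind ((toℕ i <ᵇ toℕ j) ∧ a ∧ b ∧ adj G i j)) (A≗B i) (A≗B j)

  edges-∪ : ∀ A B → Disjoint A B → edges (A ∪ B) ≡ edges A + edges B + arcs B A
  edges-∪ A B A∩B≗∅ = *-cancelˡ-≡ _ _ 2 (begin
    2 * edges (A ∪ B)                                    ≡⟨ edges-double (A ∪ B) ⟩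
    arcs (A ∪ B) (A ∪ B)                                 ≡⟨ ∑∈-∪ A B deg[ A ∪ B ] A∩B≗∅ ⟩
    arcs A (A ∪ B) + arcs B (A ∪ B)                      ≡⟨ cong₂ _+_ (arcs-∪ʳ A A B A∩B≗∅) (arcs-∪ʳ B A B A∩B≗∅) ⟩
    (arcs A A + arcs A B) + (arcs B A + arcs B B)        ≡⟨ cong₂ _+_ (cong₂ _+_ (edges-double A) (arcs-comm B A))
                                                                      (cong (arcs B A +_) (edges-double B)) ⟨
    (2 * edges A + arcs B A) + (arcs B A + 2 * edges B)  ≡⟨ regroup (edges A) (edges B) (arcs B A) ⟩
    2 * (edges A + edges B + arcs B A)                   ∎)
    where
    open ≡-Reasoning
    regroup : ∀ a b c → (2 * a + c) + (c + 2 * b) ≡ 2 * (a + b + c)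
    regroup = solve-∀

  edges-independent : ∀ A → Independent A → edges A ≡ 0
  edges-independent A indep = *-cancelˡ-≡ _ 0 2 (trans (edges-double A) no-arcs)
    where
    no-arc : ∀ i j → ind (A i ∧ A j ∧ adj G i j) ≡ 0
    no-arc i j with A i in Ai | A j in Aj
    ... | false | _     = refl
    ... | true  | false = refl
    ... | true  | true  rewrite indep i j Ai Aj = refl
    no-arcs : arcs A A ≡ 0
    no-arcs = trans (arcs-∑∑ A A)
      (trans (sum-cong-≗ λ i → trans (sum-cong-≗ (no-arc i)) (sum-replicate-zero n)) (sum-replicate-zero n))

  independent-⁅⁆ : ∀ v → Independent ⁅ v ⁆
  independent-⁅⁆ v i j i∈⁅v⁆ j∈⁅v⁆ with ⁅⁆⇒≡ v i i∈⁅v⁆ | ⁅⁆⇒≡ v j j∈⁅v⁆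
  ... | refl | refl = Graph.irrefl G v

  edges-∪-pendants : ∀ W X → Disjoint W X → Independent X → (∀ x → X x ≡ true → deg[ W ] x ≡ 1) →
                     edges (W ∪ X) ≡ edges W + count X
  edges-∪-pendants W X W∩X≗∅ indep pendant = begin
    edges (W ∪ X)                 ≡⟨ edges-∪ W X W∩X≗∅ ⟩
    edges W + edges X + arcs X W  ≡⟨ cong₂ (λ e a → edges W + e + a) (edges-independent X indep)
                                           (∑∈-≡count X pendant) ⟩
    edges W + 0 + count X         ≡⟨ cong (_+ count X) (+-identityʳ (edges W)) ⟩
    edges W + count X             ∎
    where open ≡-Reasoning

  edges-─⁅⁆ : ∀ A v → A v ≡ true → edges A ≤ edges (A ─ ⁅ v ⁆) + count (A ─ ⁅ v ⁆)
  edges-─⁅⁆ A v Av = begin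
    edges A                                  ≡⟨ edges-cong (─⁅⁆-∪⁅⁆ A v Av) ⟩
    edges (A′ ∪ ⁅ v ⁆)                       ≡⟨ edges-∪ A′ ⁅ v ⁆ (─-disjoint A ⁅ v ⁆) ⟩
    edges A′ + edges ⁅ v ⁆ + arcs ⁅ v ⁆ A′   ≡⟨ cong (λ e → edges A′ + e + arcs ⁅ v ⁆ A′)
                                                     (edges-independent ⁅ v ⁆ (independent-⁅⁆ v)) ⟩
    edges A′ + 0 + arcs ⁅ v ⁆ A′             ≤⟨ +-monoʳ-≤ (edges A′ + 0) (arcs-≤ A′ ⁅ v ⁆) ⟩
    edges A′ + 0 + count A′ * count ⁅ v ⁆    ≡⟨ cong₂ (λ e c → e + count A′ * c)
                                                      (+-identityʳ (edges A′)) (count-⁅⁆ v) ⟩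
    edges A′ + count A′ * 1                  ≡⟨ cong (edges A′ +_) (*-identityʳ (count A′)) ⟩
    edges A′ + count A′                      ∎
    where
    open ≤-Reasoning
    A′ = A ─ ⁅ v ⁆

  -- Independent and dominating sets

  independent-⊆ : ∀ {A B} → A ⊆ B → Independent B → Independent A
  independent-⊆ A⊆B indep i j Ai Aj = indep i j (A⊆B i Ai) (A⊆B j Aj)

  independent? : ∀ A → Dec (Independent A)
  independent? A = all? λ i → all? λ j → (A i ≟ true) →-dec (A j ≟ true) →-dec (adj G i j ≟ false)

  independent-∪⁅⁆ : ∀ {A v} → Independent A → (∀ u → A u ≡ true → adj G v u ≡ false) → Independent (A ∪ ⁅ v ⁆)
  independent-∪⁅⁆ {A} {v} indep v≁A i j A∪vi A∪vj with ∪⁻ A ⁅ v ⁆ i A∪vi | ∪⁻ A ⁅ v ⁆ j A∪vj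
  ... | inj₁ Ai     | inj₁ Aj     = indep i j Ai Aj
  ... | inj₁ Ai     | inj₂ j∈⁅v⁆ rewrite ⁅⁆⇒≡ v j j∈⁅v⁆ = trans (Graph.sym G i v) (v≁A i Ai)
  ... | inj₂ i∈⁅v⁆ | inj₁ Aj     rewrite ⁅⁆⇒≡ v i i∈⁅v⁆ = v≁A j Aj
  ... | inj₂ i∈⁅v⁆ | inj₂ j∈⁅v⁆ = independent-⁅⁆ v i j i∈⁅v⁆ j∈⁅v⁆

  maximal-independent : ∀ L → ∃[ I ] I ⊆ L × Independent I ×
                        (∀ v → L v ≡ true → I v ≡ true ⊎ ∃[ u ] I u ≡ true × adj G v u ≡ true)
  maximal-independent L with ∃-maximal (λ A → (A ⊆? L) ×-dec independent? A)
                                       (λ A⊆B (B⊆L , indep) → (λ i → B⊆L i ∘ A⊆B i) , independent-⊆ A⊆B indep)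
                                       ((λ _ ()) , λ _ _ ())
  ... | I , (I⊆L , indep) , max = I , I⊆L , indep , dominated
    where
    dominated : ∀ v → L v ≡ true → I v ≡ true ⊎ ∃[ u ] I u ≡ true × adj G v u ≡ true
    dominated v Lv with max v
    ... | inj₁ Iv = inj₁ Iv
    ... | inj₂ ¬P with any? (λ u → (I u ≟ true) ×-dec (adj G v u ≟ true))
    ...   | yes nbr = inj₂ nbr
    ...   | no ∄nbr = contradiction (I∪v⊆L , independent-∪⁅⁆ indep (λ u Iu → ¬-not λ vu → ∄nbr (u , Iu , vu))) ¬P
      where
      I∪v⊆L : I ∪ ⁅ v ⁆ ⊆ L
      I∪v⊆L i = [ I⊆L i , (λ i∈⁅v⁆ → subst (λ x → L x ≡ true) (sym (⁅⁆⇒≡ v i i∈⁅v⁆)) Lv) ]′ ∘ ∪⁻ I ⁅ v ⁆ i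

  count-≤-closed-neighbourhoods : ∀ L I d → (∀ v → L v ≡ true → I v ≡ true ⊎ ∃[ u ] I u ≡ true × adj G v u ≡ true) →
                                  (∀ u → I u ≡ true → degree G u ≤ d) → count L ≤ suc d * count I
  count-≤-closed-neighbourhoods L I d dominated small = begin
    count L                                 ≤⟨ count-≤-∑∈ L I (λ u → ⁅ u ⁆ ∪ adj G u) covered ⟩
    ∑∈ I (λ u → count (⁅ u ⁆ ∪ adj G u))    ≤⟨ ∑∈-≤ I closed-degree ⟩
    suc d * count I                         ∎
    where
    open ≤-Reasoning
    covered : ∀ v → L v ≡ true → ∃[ u ] I u ≡ true × (⁅ u ⁆ ∪ adj G u) v ≡ true
    covered v Lv with dominated v Lv
    ... | inj₁ Iv = v , Iv , ∪⁺ˡ ⁅ v ⁆ (adj G v) v (⁅⁆-self v)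
    ... | inj₂ (u , Iu , vu) = u , Iu , ∪⁺ʳ ⁅ u ⁆ (adj G u) v (trans (Graph.sym G u v) vu)
    loopless : ∀ u → Disjoint ⁅ u ⁆ (adj G u)
    loopless u i with i ≟ᶠ u
    ... | yes refl = Graph.irrefl G u
    ... | no _     = refl
    closed-degree : ∀ u → I u ≡ true → count (⁅ u ⁆ ∪ adj G u) ≤ suc d
    closed-degree u Iu = begin
      count (⁅ u ⁆ ∪ adj G u)     ≡⟨ count-∪ ⁅ u ⁆ (adj G u) (loopless u) ⟩
      count ⁅ u ⁆ + degree G u    ≡⟨ cong (_+ degree G u) (count-⁅⁆ u) ⟩
      suc (degree G u)            ≤⟨ s≤s (small u Iu) ⟩
      suc d                       ∎

  DominatedBy : Vector Bool n → Vector Bool n → Fin n → Set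
  DominatedBy W I x = I x ≡ true → ∃[ j ] W j ≡ true × adj G x j ≡ true

  Dominates : Vector Bool n → Vector Bool n → Set
  Dominates W I = ∀ x → DominatedBy W I x

  dominatedBy? : ∀ W I x → Dec (DominatedBy W I x)
  dominatedBy? W I x = (I x ≟ true) →-dec any? λ j → (W j ≟ true) ×-dec (adj G x j ≟ true)

  dominates-⊆ : ∀ {I W W′} → W ⊆ W′ → Dominates W I → Dominates W′ I
  dominates-⊆ W⊆W′ dom x Ix with dom x Ix
  ... | j , Wj , xj = j , W⊆W′ j Wj , xj

  ∁-dominates : ∀ {I} → Independent I → (∀ x → I x ≡ true → 1 ≤ degree G x) → Dominates (∁ I) I
  ∁-dominates {I} indep deg≥1 x Ix with ∃-member (adj G x) (deg≥1 x Ix)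
  ... | y , xy = y , ∁⁺ I y (¬-not λ Iy → contradiction (trans (sym xy) (indep x y Ix Iy)) λ ()) , xy

  PrivateNeighbour : Vector Bool n → Vector Bool n → Fin n → Set
  PrivateNeighbour I W w = ∃[ x ] I x ≡ true × adj G x w ≡ true × (∀ j → W j ≡ true → adj G x j ≡ true → j ≡ w)

  private-⊆ : ∀ {I W W′ w} → W′ ⊆ W → PrivateNeighbour I W w → PrivateNeighbour I W′ w
  private-⊆ W′⊆W (x , Ix , xw , only) = x , Ix , xw , λ j W′j → only j (W′⊆W j W′j)

  private⇒∉ : ∀ {I W w} → Independent I → PrivateNeighbour I W w → I w ≡ false
  private⇒∉ {w = w} indep (x , Ix , xw , _) = ¬-not λ Iw → contradiction (trans (sym xw) (indep x w Ix Iw)) λ ()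

  private⇒deg≡1 : ∀ {W x w} → W w ≡ true → adj G x w ≡ true → (∀ j → W j ≡ true → adj G x j ≡ true → j ≡ w) →
                  deg[ W ] x ≡ 1
  private⇒deg≡1 {W} {x} {w} Ww xw only = count≡1 (W ∩ adj G x) w (∩⁺ W (adj G x) w Ww xw) λ j Wj∧xj →
    subst (λ y → ⁅ w ⁆ y ≡ true) (sym (only j (∩⁻ˡ W (adj G x) j Wj∧xj) (∩⁻ʳ W (adj G x) j Wj∧xj))) (⁅⁆-self w)

  minimal-dominating : ∀ {I W} → Dominates W I →
                       ∃[ M ] Dominates M I × (∀ w → M w ≡ true → PrivateNeighbour I M w)
  minimal-dominating {I} dom with ∃-minimal (λ A → all? (dominatedBy? A I)) dominates-⊆ dom
  ... | M , domM , minimal = M , domM , private-neighbour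
    where
    private-neighbour : ∀ w → M w ≡ true → PrivateNeighbour I M w
    private-neighbour w Mw with ¬∀⟶∃¬ n (DominatedBy (M ─ ⁅ w ⁆) I) (dominatedBy? (M ─ ⁅ w ⁆) I) (minimal w Mw)
    ... | x , ¬dom-x with I x ≟ true
    ...   | no ¬Ix = contradiction (λ Ix → contradiction Ix ¬Ix) ¬dom-x
    ...   | yes Ix with domM x Ix
    ...     | j , Mj , xj = x , Ix , subst (λ y → adj G x y ≡ true) (only j Mj xj) xj , only
      where
      only : ∀ j → M j ≡ true → adj G x j ≡ true → j ≡ w
      only j Mj xj with j ≟ᶠ w
      ... | yes j≡w = j≡w
      ... | no j≢w = contradiction (λ _ → j , ─⁅⁆⁺ M Mj j≢w , xj) ¬dom-x

  -- Realising edge counts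

  add-private-neighbours : ∀ {I W} → Independent I → (∀ w → W w ≡ true → PrivateNeighbour I W w) →
                           ∀ r → r ≤ count W → ∃[ S ] edges S ≡ edges W + r
  add-private-neighbours {I} {W} indep priv r r≤∣W∣ = extend (⊆-of-size Pendant r (≤-trans r≤∣W∣ ∣W∣≤∣Pendant∣))
    where
    OneNeighbour Pendant : Vector Bool n
    OneNeighbour x = deg[ W ] x ≡ᵇ 1
    Pendant = I ∩ OneNeighbour
    pendant⇒deg≡1 : ∀ x → Pendant x ≡ true → deg[ W ] x ≡ 1
    pendant⇒deg≡1 x = ≡ᵇ⇒≡ _ 1 ∘ Equivalence.from T-≡ ∘ ∩⁻ʳ I OneNeighbour x
    ∣W∣≤∣Pendant∣ : count W ≤ count Pendant
    ∣W∣≤∣Pendant∣ = begin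
      count W               ≤⟨ count-≤-∑∈ W Pendant (λ x → W ∩ adj G x) covered ⟩
      ∑∈ Pendant deg[ W ]   ≡⟨ ∑∈-≡count Pendant pendant⇒deg≡1 ⟩
      count Pendant         ∎
      where
      open ≤-Reasoning
      covered : ∀ w → W w ≡ true → ∃[ x ] Pendant x ≡ true × (W ∩ adj G x) w ≡ true
      covered w Ww with priv w Ww
      ... | x , Ix , xw , only = x , ∩⁺ I OneNeighbour x Ix (Equivalence.to T-≡ (≡⇒≡ᵇ _ 1 (private⇒deg≡1 Ww xw only)))
                                   , ∩⁺ W (adj G x) w Ww xw
    extend : ∃[ X ] X ⊆ Pendant × count X ≡ r → ∃[ S ] edges S ≡ edges W + r
    extend (X , X⊆P , ∣X∣≡r) = W ∪ X , (begin
      edges (W ∪ X)       ≡⟨ edges-∪-pendants W X W∩X≗∅ (independent-⊆ X⊆I indep) (λ x → pendant⇒deg≡1 x ∘ X⊆P x) ⟩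
      edges W + count X   ≡⟨ cong (edges W +_) ∣X∣≡r ⟩
      edges W + r         ∎)
      where
      open ≡-Reasoning
      X⊆I : X ⊆ I
      X⊆I x = ∩⁻ˡ I OneNeighbour x ∘ X⊆P x
      W∩X≗∅ : Disjoint W X
      W∩X≗∅ w with W w in Ww
      ... | false = refl
      ... | true  = ⊆⇒∉ X I w X⊆I (private⇒∉ indep (priv w Ww))

  edges-interval : ∀ {I} → Independent I → ∀ W → (∀ w → W w ≡ true → PrivateNeighbour I W w) →
                   ∀ t → t ≤ edges W + count W → ∃[ S ] edges S ≡ t
  edges-interval {I} indep W priv = go (count W) W refl priv
    where
    go : ∀ m W → count W ≡ m → (∀ w → W w ≡ true → PrivateNeighbour I W w) →
         ∀ t → t ≤ edges W + m → ∃[ S ] edges S ≡ t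
    go m W ∣W∣≡m priv t t≤ with edges W ≤? t
    go m W ∣W∣≡m priv t t≤ | yes e≤t = grow (add-private-neighbours indep priv (t ∸ edges W) r≤∣W∣)
      where
      r≤∣W∣ : t ∸ edges W ≤ count W
      r≤∣W∣ = subst (t ∸ edges W ≤_) (sym ∣W∣≡m) (m≤n+o⇒m∸n≤o t (edges W) t≤)
      grow : ∃[ S ] edges S ≡ edges W + (t ∸ edges W) → ∃[ S ] edges S ≡ t
      grow (S , eS) = S , trans eS (m+[n∸m]≡n e≤t)
    go zero W ∣W∣≡0 priv t t≤ | no e≰t = contradiction (subst (_≤ t) (sym (edges-independent W empty)) z≤n) e≰t
      where
      empty : Independent W
      empty i _ Wi _ = contradiction (subst (1 ≤_) ∣W∣≡0 (∈⇒1≤count W i Wi)) λ ()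
    go (suc m) W ∣W∣≡1+m priv t t≤ | no e≰t = shrink (∃-member W (subst (0 <_) (sym ∣W∣≡1+m) (s≤s z≤n)))
      where
      shrink : ∃[ v ] W v ≡ true → ∃[ S ] edges S ≡ t
      shrink (v , Wv) = go m (W ─ ⁅ v ⁆) ∣W─v∣≡m (λ w → private-⊆ W─v⊆W ∘ priv w ∘ W─v⊆W w) t
                           (≤-trans (<⇒≤ (≰⇒> e≰t)) e≤)
        where
        W─v⊆W : W ─ ⁅ v ⁆ ⊆ W
        W─v⊆W = ∩⁻ˡ W (∁ ⁅ v ⁆)
        ∣W─v∣≡m : count (W ─ ⁅ v ⁆) ≡ m
        ∣W─v∣≡m = suc-injective (trans (sym (count-─⁅⁆ W v Wv)) ∣W∣≡1+m)
        e≤ : edges W ≤ edges (W ─ ⁅ v ⁆) + m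
        e≤ = subst (λ c → edges W ≤ edges (W ─ ⁅ v ⁆) + c) ∣W─v∣≡m (edges-─⁅⁆ W v Wv)

  star-edges : ∀ {I} k w → Independent I → k ≤ deg[ I ] w → ∃[ S ] edges S ≡ k
  star-edges {I} k w indep k≤deg = leaves (⊆-of-size (I ∩ adj G w) k k≤deg)
    where
    leaves : ∃[ X ] X ⊆ I ∩ adj G w × count X ≡ k → ∃[ S ] edges S ≡ k
    leaves (X , X⊆N , ∣X∣≡k) = ⁅ w ⁆ ∪ X , (begin
      edges (⁅ w ⁆ ∪ X)          ≡⟨ edges-∪-pendants ⁅ w ⁆ X disjoint (independent-⊆ X⊆I indep) pendant ⟩
      edges ⁅ w ⁆ + count X      ≡⟨ cong₂ _+_ (edges-independent ⁅ w ⁆ (independent-⁅⁆ w)) ∣X∣≡k ⟩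
      k                          ∎)
      where
      open ≡-Reasoning
      X⊆I : X ⊆ I
      X⊆I x = ∩⁻ˡ I (adj G w) x ∘ X⊆N x
      wx : ∀ x → X x ≡ true → adj G w x ≡ true
      wx x = ∩⁻ʳ I (adj G w) x ∘ X⊆N x
      pendant : ∀ x → X x ≡ true → deg[ ⁅ w ⁆ ] x ≡ 1
      pendant x Xx = private⇒deg≡1 (⁅⁆-self w) (trans (Graph.sym G x w) (wx x Xx)) λ j j∈⁅w⁆ _ → ⁅⁆⇒≡ w j j∈⁅w⁆
      disjoint : Disjoint ⁅ w ⁆ X
      disjoint i with i ≟ᶠ w
      ... | no  _    = refl
      ... | yes refl = ¬-not λ Xw → contradiction (trans (sym (wx w Xw)) (Graph.irrefl G w)) λ ()

  edges-from-large-independent : ∀ {I} k → Independent I → (∀ x → I x ≡ true → 1 ≤ degree G x) →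
                                 k * k < count I → ∃[ S ] edges S ≡ suc k
  edges-from-large-independent {I} k indep deg≥1 k²<∣I∣ with any? (λ w → suc k ≤? deg[ I ] w)
  ... | yes (w , k<deg) = star-edges (suc k) w indep k<deg
  ... | no ∄w with minimal-dominating (∁-dominates indep deg≥1)
  ...   | W , domW , priv = edges-interval indep W priv (suc k) (≤-trans k<∣W∣ (m≤n+m _ _))
    where
    ∣I∣≤k∣W∣ : count I ≤ k * count W
    ∣I∣≤k∣W∣ = begin
      count I                  ≤⟨ count-≤-∑∈ I W (λ w → I ∩ adj G w) covered ⟩
      ∑∈ W deg[ I ]            ≤⟨ ∑∈-≤ W (λ w _ → ≤-pred (≰⇒> λ k<deg → ∄w (w , k<deg))) ⟩
      k * count W              ∎
      where
      open ≤-Reasoning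
      covered : ∀ x → I x ≡ true → ∃[ w ] W w ≡ true × (I ∩ adj G w) x ≡ true
      covered x Ix with domW x Ix
      ... | w , Ww , xw = w , Ww , ∩⁺ I (adj G w) x Ix (trans (Graph.sym G w x) xw)
    k<∣W∣ : suc k ≤ count W
    k<∣W∣ = *-cancelˡ-< k k (count W) (<-≤-trans k²<∣I∣ ∣I∣≤k∣W∣)

lowDeg : ∀ {n} → Graph n → ℕ → Vector Bool n
lowDeg G d v = (1 ≤ᵇ degree G v) ∧ (degree G v ≤ᵇ d)

inducedEdges≡edges : ∀ {n} (G : Graph n) S → inducedEdges G (Vec.tabulate S) ≡ edges G S
inducedEdges≡edges {n} G S =
  trans (sum-map-tabulate (count ∘ P) id) (sum-cong-≗ λ i → trans (count≡∑∈ (P i)) (sum-cong-≗ λ j →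
    cong₂ (λ a b → ind ((toℕ i <ᵇ toℕ j) ∧ a ∧ b ∧ adj G i j)) (lookup∘tabulate S i) (lookup∘tabulate S j)))
  where
  P : Fin n → Vector Bool n
  P i j = (toℕ i <ᵇ toℕ j) ∧ Vec.lookup (Vec.tabulate S) i ∧ Vec.lookup (Vec.tabulate S) j ∧ adj G i j

induced-subgraph : ∀ {n} (G : Graph n) {k} → ∃[ S ] edges G S ≡ suc k → HasKEdgeInducedSubgraph G (suc k)
induced-subgraph G (S , eS) with any? (λ i → S i ≟ true)
... | yes (i , Si) = Vec.tabulate S , (i , lookup⇒[]= i (Vec.tabulate S) (trans (lookup∘tabulate S i) Si))
                                     , trans (inducedEdges≡edges G S) eS
... | no ∄i = contradiction (trans (sym eS) (edges-independent G S λ i _ Si _ → contradiction (i , Si) ∄i)) λ ()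

lemma3p12 : (d k : ℕ) → d > 0 → k > 0 → (n : ℕ) → (G : Graph (suc n)) →
    lowDegCount G d > (d + 1) * ((k ∸ 1) ^ 2) →
    HasKEdgeInducedSubgraph G k
lemma3p12 d (suc k) _ _ n G many = from-independent (maximal-independent G (lowDeg G d))
  where
  from-independent : ∃[ I ] I ⊆ lowDeg G d × Independent G I ×
                     (∀ v → lowDeg G d v ≡ true → I v ≡ true ⊎ ∃[ u ] I u ≡ true × adj G v u ≡ true) →
                     HasKEdgeInducedSubgraph G (suc k)
  from-independent (I , I⊆L , indep , dominated) =
    induced-subgraph G (edges-from-large-independent G k indep deg≥1 k²<∣I∣)
    where
    deg≥1 : ∀ x → I x ≡ true → 1 ≤ degree G x
    deg≥1 x = ≤ᵇ⇒≤ 1 _ ∘ Equivalence.from T-≡ ∘ ∩⁻ˡ (λ v → 1 ≤ᵇ degree G v) (λ v → degree G v ≤ᵇ d) x ∘ I⊆L x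
    deg≤d : ∀ x → I x ≡ true → degree G x ≤ d
    deg≤d x = ≤ᵇ⇒≤ _ d ∘ Equivalence.from T-≡ ∘ ∩⁻ʳ (λ v → 1 ≤ᵇ degree G v) (λ v → degree G v ≤ᵇ d) x ∘ I⊆L x
    k²<∣I∣ : k * k < count I
    k²<∣I∣ = *-cancelˡ-< (suc d) (k * k) (count I) (begin-strict
      suc d * (k * k)            ≡⟨ cong₂ _*_ (+-comm 1 d) (cong (k *_) (sym (*-identityʳ k))) ⟩
      (d + 1) * (k ^ 2)          <⟨ many ⟩
      count (lowDeg G d)         ≤⟨ count-≤-closed-neighbourhoods G (lowDeg G d) I d dominated deg≤d ⟩
      suc d * count I            ∎)
      where open ≤-Reasoning
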